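{- Let $m\ge 1$ and $\mathcal D_m=\bigcup_{n\ge1}\mathcal D_{m,n}$ be the set of non-empty $m$-Dyck paths. Equipped with the product $*$, $\mathcal D_m$ is a free monoid with unit $10^m$, graded by (size $-1$), freely generated by the paths $D(w_1,w_2,\dots,w_{i-1},10^m,\varnothing,\dots,\varnothing)$ with $1\le i\le m+1$ and $w_j\in\mathcal D_m\cup\{\varnothing\}$ for all $j$.
   Context: An $m$-Dyck path of size $n$ is a word with $n$ letters $1$ (up steps $(+m,+m)$) and $mn$ letters $0$ (down steps $(+1,-1)$) whose lattice path from $(0,0)$ never goes strictly below the horizontal axis; $\mathcal D_{m,n}$ is the set of them and $\varnothing$ is the empty path. A peak is an occurrence of the factor $10^m$. Every non-empty $m$-Dyck path has a unique expression $1w_10\,w_20\cdots w_m0\,w_{m+1}$ with $w_1,\dots,w_{m+1}$ (possibly empty) $m$-Dyck paths; this path is denoted $D(w_1,\dots,w_{m+1})$ (with $m+1$ arguments). For non-empty $w_1,w_2$, the product $w_1*w_2$ is the path obtained from $w_1$ by replacing its rightmost peak (the factor $10^m$ formed by the last up step and the $m$ down steps following it) by $w_2$; one has $|w_1*w_2|=|w_1|+|w_2|-1$ where $|\cdot|$ denotes size. -}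

module Defs where

open import Data.Nat using (ℕ; zero; suc; _+_; _∸_; _<_; _>_)
open import Data.Bool using (Bool; true; false; if_then_else_; _∨_)
open import Data.List using (List; []; _∷_; _++_; replicate; length; concatMap)
open import Data.List.Relation.Unary.All using (All)
open import Data.Vec using (Vec; _∷_; toList; lookup)
open import Data.Fin using (Fin; toℕ)
open import Data.Product using (Σ; ∃; _×_; _,_)
open import Relation.Binary.PropositionalEquality using (_≡_; _≢_)

-- Words: `true` = letter 1 (up step (+m,+m)), `false` = letter 0 (down step (+1,-1)).
Word : Set
Word = List Bool

-- Walk m h w : reading w from height h, the path never goes strictly below
-- the axis and ends at height 0.  (Heights are natural numbers, so a down
-- step from height 0 is impossible.)
data Walk (m : ℕ) : ℕ → Word → Set where
  end  : Walk m 0 []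
  up   : ∀ {h w} → Walk m (h + m) w → Walk m h (true ∷ w)
  down : ∀ {h w} → Walk m h w → Walk m (suc h) (false ∷ w)

IsDyck : ℕ → Word → Set
IsDyck m w = Walk m 0 w

IsNonEmptyDyck : ℕ → Word → Set
IsNonEmptyDyck m w = IsDyck m w × w ≢ []

size : Word → ℕ
size []          = 0
size (true ∷ w)  = suc (size w)
size (false ∷ w) = size w

hasUp : Word → Bool
hasUp []      = false
hasUp (b ∷ w) = b ∨ hasUp w

peak : ℕ → Word
peak m = true ∷ replicate m false

-- w₁ * w₂ : replace the rightmost peak of w₁ (the last up step together with
-- the m down steps following it) by w₂.  If the last 1 of w₁ is followed by
-- k down steps (k ≥ m for an m-Dyck path), the result is
-- (prefix before last 1) ++ w₂ ++ 0^(k - m).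
star : ℕ → Word → Word → Word
star m []          w₂ = w₂
star m (false ∷ w) w₂ = false ∷ star m w w₂
star m (true ∷ w)  w₂ =
  if hasUp w then true ∷ star m w w₂
             else w₂ ++ replicate (length w ∸ m) false

D : (m : ℕ) → Vec Word (suc m) → Word
D m (w ∷ ws) = true ∷ (w ++ concatMap (λ v → false ∷ v) (toList ws))

-- the generators D(w₁,…,w_{i-1},10^m,∅,…,∅), 1 ≤ i ≤ m+1, w_j ∈ 𝒟_m ∪ {∅}
-- (position i is the Fin index i with toℕ i = i - 1)
IsGenerator : ℕ → Word → Set
IsGenerator m g =
  Σ (Fin (suc m)) λ i → Σ (Vec Word (suc m)) λ ws →
      (∀ j → toℕ j < toℕ i → IsDyck m (lookup ws j))
    × lookup ws i ≡ peak m
    × (∀ j → toℕ j > toℕ i → lookup ws j ≡ [])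
    × g ≡ D m ws

prod : ℕ → List Word → Word
prod m []       = peak m
prod m (g ∷ gs) = star m g (prod m gs)

-- Every non-empty m-Dyck path ends with its rightmost peak: it is p 1 0^(h+m), where p
-- leaves the path at height h, and then u * v = p v 0^h.  So * inserts v at a point of
-- height h, which gives closure, the unit laws, associativity and the grading at once.
-- For freeness, cut a non-empty path 1w at the first passages of w through the heights
-- m-1, …, 0: w = w₁0 ⋯ w_k0 x 0^r with Dyck blocks w_j and x the last non-empty component
-- (or w = 0^m, the unit).  Then 1w = g * x for the generator g = 1w₁0 ⋯ w_k0 10^m 0^r and
-- x is smaller, and first passages are unique, so the factorisation is unique.
module Submission where

open import Defs
open import Data.Nat using (ℕ; zero; suc; _≤_; _+_; _∸_; _<_; _>_; z≤n; s≤s)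
open import Data.Nat.Properties
  using (suc-injective; 0≢1+n; +-suc; +-comm; +-identityʳ; +-cancelʳ-≡; m+n∸n≡m;
         m≤m+n; m≤n+m; ≤-refl; ≤-trans; +-commutativeSemigroup)
open import Algebra.Properties.CommutativeSemigroup +-commutativeSemigroup
  using () renaming (xy∙z≈xz∙y to +-right-comm)
open import Data.Bool using (true; false)
open import Data.Bool.Properties using (∨-zeroʳ; not-¬)
open import Data.List using (List; []; _∷_; _++_; replicate; length; concatMap)
open import Data.List.Properties
  using (++-assoc; ++-identityʳ; ++-cancelʳ; ++-conicalˡ; ++-conicalʳ; length-replicate; ∷-injectiveʳ)
open import Data.List.Relation.Unary.All using (All; []; _∷_)
open import Data.Vec using (Vec; []; _∷_; toList; lookup)
import Data.Vec as Vec
open import Data.Vec.Properties using (lookup-replicate)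
open import Data.Fin using (Fin; toℕ; zero; suc)
open import Data.Product using (Σ; _×_; _,_; proj₂; map₁)
open import Data.Sum using (_⊎_; inj₁; inj₂)
open import Data.Empty using (⊥-elim)
open import Function using (_∘_)
open import Relation.Nullary using (¬_)
open import Relation.Binary.PropositionalEquality
open ≡-Reasoning

zeros : ℕ → Word
zeros k = replicate k false

zeros-++ : ∀ a b → zeros a ++ zeros b ≡ zeros (a + b)
zeros-++ zero    b = refl
zeros-++ (suc a) b = cong (false ∷_) (zeros-++ a b)

size-++ : ∀ u v → size (u ++ v) ≡ size u + size v
size-++ []          v = refl
size-++ (true ∷ u)  v = cong suc (size-++ u v)
size-++ (false ∷ u) v = size-++ u v

size-zeros : ∀ k → size (zeros k) ≡ 0
size-zeros zero    = refl
size-zeros (suc k) = size-zeros k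

size-infix : ∀ u v w → size v ≤ size (u ++ v ++ w)
size-infix u v w rewrite size-++ u (v ++ w) | size-++ v w =
  ≤-trans (m≤m+n (size v) (size w)) (m≤n+m (size v + size w) (size u))

hasUp-zeros : ∀ k → hasUp (zeros k) ≡ false
hasUp-zeros zero    = refl
hasUp-zeros (suc k) = hasUp-zeros k

hasUp-++-true∷ : ∀ p z → hasUp (p ++ true ∷ z) ≡ true
hasUp-++-true∷ []      z = refl
hasUp-++-true∷ (b ∷ p) z rewrite hasUp-++-true∷ p z = ∨-zeroʳ b

hasUp⇒≢zeros : ∀ {z} k → hasUp z ≡ true → zeros k ≢ z
hasUp⇒≢zeros k up-z refl = not-¬ (hasUp-zeros k) up-z

¬hasUp⇒zeros : ∀ w → hasUp w ≡ false → w ≡ zeros (length w)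
¬hasUp⇒zeros []          _  = refl
¬hasUp⇒zeros (false ∷ w) ¬up = cong (false ∷_) (¬hasUp⇒zeros w ¬up)

hasUp⇒lastUp : ∀ w → hasUp w ≡ true → Σ Word λ p → Σ ℕ λ k → w ≡ p ++ true ∷ zeros k
hasUp⇒lastUp (b ∷ w) _ with hasUp w in up-w
... | true with hasUp⇒lastUp w up-w
...   | p , k , w≡ = b ∷ p , k , cong (b ∷_) w≡
hasUp⇒lastUp (true ∷ w) _ | false = [] , length w , cong (true ∷_) (¬hasUp⇒zeros w up-w)

interleave-empty : ∀ {n} (ws : Vec Word n) → (∀ j → lookup ws j ≡ []) →
                   concatMap (false ∷_) (toList ws) ≡ zeros n
interleave-empty []       _     = refl
interleave-empty (w ∷ ws) empty with empty zero
... | refl = cong (false ∷_) (interleave-empty ws (empty ∘ suc))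

module _ (m : ℕ) where

  walk-zeros : ∀ k → Walk m k (zeros k)
  walk-zeros zero    = end
  walk-zeros (suc k) = down (walk-zeros k)

  walk-zeros⁻¹ : ∀ {h} k → Walk m h (zeros k) → h ≡ k
  walk-zeros⁻¹ zero    end        = refl
  walk-zeros⁻¹ (suc k) (down wk) = cong suc (walk-zeros⁻¹ k wk)

  walk-++ : ∀ {k h v s} → Walk m k v → Walk m h s → Walk m (k + h) (v ++ s)
  walk-++                 end       walk-s = walk-s
  walk-++ {h = h} {s = s} (up {k} {v} walk-v) walk-s =
    up (subst (λ z → Walk m z (v ++ s)) (+-right-comm k m h) (walk-++ walk-v walk-s))
  walk-++                 (down walk-v) walk-s = down (walk-++ walk-v walk-s)

  walk-++⁻¹ʳ : ∀ p {h s} → Walk m h (p ++ s) → Σ ℕ λ h' → Walk m h' s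
  walk-++⁻¹ʳ []          wk        = _ , wk
  walk-++⁻¹ʳ (true ∷ p)  (up wk)   = walk-++⁻¹ʳ p wk
  walk-++⁻¹ʳ (false ∷ p) (down wk) = walk-++⁻¹ʳ p wk

  walk-replace-suffix : ∀ p {h s s'} → Walk m h (p ++ s) →
                        (∀ {h'} → Walk m h' s → Walk m h' s') → Walk m h (p ++ s')
  walk-replace-suffix []          wk        f = f wk
  walk-replace-suffix (true ∷ p)  (up wk)   f = up (walk-replace-suffix p wk f)
  walk-replace-suffix (false ∷ p) (down wk) f = down (walk-replace-suffix p wk f)

  ¬walk-++-false∷ : ∀ {k} a {b} → Walk m k a → ¬ Walk m k (a ++ false ∷ b)
  ¬walk-++-false∷ []          end        ()
  ¬walk-++-false∷ (true ∷ a)  (up wk)   (up wk')   = ¬walk-++-false∷ a wk wk'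
  ¬walk-++-false∷ (false ∷ a) (down wk) (down wk') = ¬walk-++-false∷ a wk wk'

  walk-prefix-unique : ∀ {k} a a' {b b'} → Walk m k a → Walk m k a' →
                       a ++ false ∷ b ≡ a' ++ false ∷ b' → a ≡ a' × b ≡ b'
  walk-prefix-unique []          []           end       end        e  = refl , ∷-injectiveʳ e
  walk-prefix-unique []          (true ∷ a')  end       (up _)     ()
  walk-prefix-unique (true ∷ a)  []           (up _)    end        ()
  walk-prefix-unique (true ∷ a)  (false ∷ a') (up _)    (down _)   ()
  walk-prefix-unique (false ∷ a) (true ∷ a')  (down _)  (up _)     ()
  walk-prefix-unique (true ∷ a)  (true ∷ a')  (up wk)   (up wk')   e =
    map₁ (cong (true ∷_)) (walk-prefix-unique a a' wk wk' (∷-injectiveʳ e))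
  walk-prefix-unique (false ∷ a) (false ∷ a') (down wk) (down wk') e =
    map₁ (cong (false ∷_)) (walk-prefix-unique a a' wk wk' (∷-injectiveʳ e))

  first-passage : ∀ k h {H w} → Walk m H w → H ≡ k + suc h →
                  Σ Word λ v → Σ Word λ w' → Walk m k v × w ≡ v ++ false ∷ w' × Walk m h w'
  first-passage k h end e = ⊥-elim (0≢1+n (trans e (+-suc k h)))
  first-passage k h (up wk) e
    with first-passage (k + m) h wk (trans (cong (_+ m) e) (+-right-comm k (suc h) m))
  ... | v , w' , walk-v , refl , walk-w' = true ∷ v , w' , up walk-v , refl , walk-w'
  first-passage zero    h (down wk) refl = [] , _ , end , refl , wk
  first-passage (suc k) h (down wk) e with first-passage k h wk (suc-injective e)
  ... | v , w' , walk-v , refl , walk-w' = false ∷ v , w' , down walk-v , refl , walk-w'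

  nonEmptyDyck-hasUp-infix : ∀ p {x} z → IsNonEmptyDyck m x → hasUp (p ++ x ++ z) ≡ true
  nonEmptyDyck-hasUp-infix p z (end  , x≢[]) = ⊥-elim (x≢[] refl)
  nonEmptyDyck-hasUp-infix p z (up _ , _)    = hasUp-++-true∷ p _

  nonEmptyDyck-lastPeak : ∀ {u} → IsNonEmptyDyck m u →
                          Σ Word λ p → Σ ℕ λ h → u ≡ p ++ true ∷ zeros (h + m)
  nonEmptyDyck-lastPeak (end , u≢[]) = ⊥-elim (u≢[] refl)
  nonEmptyDyck-lastPeak {true ∷ u} (walk-u , _) with hasUp⇒lastUp (true ∷ u) refl
  ... | p , k , u≡ with walk-++⁻¹ʳ p (subst (Walk m 0) u≡ walk-u)
  ...   | h , up walk-zeros-k with walk-zeros⁻¹ k walk-zeros-k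
  ...     | refl = p , h , u≡

  star-++-true∷zeros : ∀ p k x → star m (p ++ true ∷ zeros k) x ≡ p ++ x ++ zeros (k ∸ m)
  star-++-true∷zeros []          k x rewrite hasUp-zeros k | length-replicate k {false} = refl
  star-++-true∷zeros (false ∷ p) k x = cong (false ∷_) (star-++-true∷zeros p k x)
  star-++-true∷zeros (true ∷ p)  k x rewrite hasUp-++-true∷ p (zeros k) =
    cong (true ∷_) (star-++-true∷zeros p k x)

  star-lastPeak : ∀ p h x → star m (p ++ true ∷ zeros (h + m)) x ≡ p ++ x ++ zeros h
  star-lastPeak p h x =
    trans (star-++-true∷zeros p (h + m) x) (cong (λ k → p ++ x ++ zeros k) (m+n∸n≡m h m))

  star-closed : ∀ u v → IsNonEmptyDyck m u → IsNonEmptyDyck m v → IsNonEmptyDyck m (star m u v)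
  star-closed u v (walk-u , u≢[]) (walk-v , v≢[]) with nonEmptyDyck-lastPeak (walk-u , u≢[])
  ... | p , h , refl rewrite star-lastPeak p h v =
    walk-replace-suffix p walk-u insert-v , λ e → v≢[] (++-conicalˡ v _ (++-conicalʳ p _ e))
    where
      insert-v : ∀ {h'} → Walk m h' (true ∷ zeros (h + m)) → Walk m h' (v ++ zeros h)
      insert-v {h'} (up wk) rewrite +-cancelʳ-≡ m h' h (walk-zeros⁻¹ (h + m) wk) =
        walk-++ walk-v (walk-zeros h)

  peak-nonEmptyDyck : IsNonEmptyDyck m (peak m)
  peak-nonEmptyDyck = up (walk-zeros m) , λ ()

  star-identityˡ : ∀ u → star m (peak m) u ≡ u
  star-identityˡ u = trans (star-lastPeak [] 0 u) (++-identityʳ u)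

  star-identityʳ : ∀ u → IsNonEmptyDyck m u → star m u (peak m) ≡ u
  star-identityʳ u ne-u with nonEmptyDyck-lastPeak ne-u
  ... | p , h , refl = begin
    star m (p ++ true ∷ zeros (h + m)) (peak m) ≡⟨ star-lastPeak p h (peak m) ⟩
    p ++ true ∷ zeros m ++ zeros h              ≡⟨ cong (λ z → p ++ true ∷ z) (zeros-++ m h) ⟩
    p ++ true ∷ zeros (m + h)                   ≡⟨ cong (λ k → p ++ true ∷ zeros k) (+-comm m h) ⟩
    p ++ true ∷ zeros (h + m)                   ∎

  star-lastPeak-lastPeak : ∀ p a q b →
    star m (p ++ true ∷ zeros (a + m)) (q ++ true ∷ zeros (b + m))
      ≡ (p ++ q) ++ true ∷ zeros (b + a + m)
  star-lastPeak-lastPeak p a q b = begin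
    star m (p ++ true ∷ zeros (a + m)) (q ++ true ∷ zeros (b + m))
      ≡⟨ star-lastPeak p a _ ⟩
    p ++ (q ++ true ∷ zeros (b + m)) ++ zeros a
      ≡⟨ cong (p ++_) (++-assoc q _ _) ⟩
    p ++ q ++ true ∷ zeros (b + m) ++ zeros a
      ≡⟨ cong (λ z → p ++ q ++ true ∷ z) (zeros-++ (b + m) a) ⟩
    p ++ q ++ true ∷ zeros (b + m + a)
      ≡⟨ cong (λ k → p ++ q ++ true ∷ zeros k) (+-right-comm b m a) ⟩
    p ++ q ++ true ∷ zeros (b + a + m)
      ≡⟨ ++-assoc p q _ ⟨
    (p ++ q) ++ true ∷ zeros (b + a + m) ∎

  star-assoc : ∀ u v w → IsNonEmptyDyck m u → IsNonEmptyDyck m v →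
               star m (star m u v) w ≡ star m u (star m v w)
  star-assoc u v w ne-u ne-v with nonEmptyDyck-lastPeak ne-u | nonEmptyDyck-lastPeak ne-v
  ... | p , a , refl | q , b , refl = begin
    star m (star m (p ++ true ∷ zeros (a + m)) (q ++ true ∷ zeros (b + m))) w
      ≡⟨ cong (λ z → star m z w) (star-lastPeak-lastPeak p a q b) ⟩
    star m ((p ++ q) ++ true ∷ zeros (b + a + m)) w
      ≡⟨ star-lastPeak (p ++ q) (b + a) w ⟩
    (p ++ q) ++ w ++ zeros (b + a)
      ≡⟨ cong (λ z → (p ++ q) ++ w ++ z) (zeros-++ b a) ⟨
    (p ++ q) ++ w ++ zeros b ++ zeros a
      ≡⟨ ++-assoc p q _ ⟩
    p ++ q ++ w ++ zeros b ++ zeros a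
      ≡⟨ cong (p ++_) (trans (++-assoc q _ _) (cong (q ++_) (++-assoc w _ _))) ⟨
    p ++ (q ++ w ++ zeros b) ++ zeros a
      ≡⟨ star-lastPeak p a _ ⟨
    star m (p ++ true ∷ zeros (a + m)) (q ++ w ++ zeros b)
      ≡⟨ cong (star m (p ++ true ∷ zeros (a + m))) (star-lastPeak q b w) ⟨
    star m (p ++ true ∷ zeros (a + m)) (star m (q ++ true ∷ zeros (b + m)) w) ∎

  size-star : ∀ u v → IsNonEmptyDyck m u → size (star m u v) + 1 ≡ size u + size v
  size-star u v ne-u with nonEmptyDyck-lastPeak ne-u
  ... | p , h , refl rewrite star-lastPeak p h v
        | size-++ p (v ++ zeros h) | size-++ v (zeros h) | size-zeros h | +-identityʳ (size v)
        | size-++ p (true ∷ zeros (h + m)) | size-zeros (h + m)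
        = +-right-comm (size p) (size v) 1

  blocks : List Word → Word
  blocks []       = []
  blocks (w ∷ ws) = w ++ false ∷ blocks ws

  blocks-∷-++ : ∀ w ws z → blocks (w ∷ ws) ++ z ≡ w ++ false ∷ blocks ws ++ z
  blocks-∷-++ w ws z = ++-assoc w (false ∷ blocks ws) z

  walk-blocks : ∀ ws {h s} → All (IsDyck m) ws → Walk m h s → Walk m (length ws + h) (blocks ws ++ s)
  walk-blocks []       []                walk-s = walk-s
  walk-blocks (w ∷ ws) {h} {s} (walk-w ∷ walk-ws) walk-s =
    subst (Walk m (suc (length ws + h))) (sym (blocks-∷-++ w ws s))
      (walk-++ walk-w (down (walk-blocks ws walk-ws walk-s)))

  Decomposition : ℕ → Word → Set
  Decomposition h w = Σ (List Word) λ ws → Σ Word λ x → Σ ℕ λ r →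
    length ws + r ≡ h × All (IsDyck m) ws × IsNonEmptyDyck m x × w ≡ blocks ws ++ x ++ zeros r

  decompose : ∀ h {w} → Walk m h w → w ≡ zeros h ⊎ Decomposition h w
  decompose zero end     = inj₁ refl
  decompose zero (up wk) = inj₂ ([] , _ , 0 , refl , [] , (up wk , λ ()) , sym (++-identityʳ _))
  decompose (suc h) wk with first-passage 0 h wk refl
  ... | v , w' , walk-v , refl , walk-w' with decompose h walk-w'
  ...   | inj₂ (ws , x , r , len , walk-ws , ne-x , refl) =
          inj₂ (v ∷ ws , x , r , cong suc len , walk-v ∷ walk-ws , ne-x , sym (blocks-∷-++ v ws _))
  decompose (suc h) wk | []    , _ , _      , refl , _ | inj₁ refl = inj₁ refl
  decompose (suc h) wk | b ∷ v , _ , walk-v , refl , _ | inj₁ refl =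
          inj₂ ([] , b ∷ v , suc h , refl , [] , (walk-v , λ ()) , refl)

  dyck-++-zeros≢dyck-++-false∷ : ∀ x w r {z} → IsDyck m x → IsDyck m w → hasUp z ≡ true →
                                 x ++ zeros r ≢ w ++ false ∷ z
  dyck-++-zeros≢dyck-++-false∷ x w zero walk-x walk-w _ e =
    ¬walk-++-false∷ w walk-w (subst (IsDyck m) (trans (sym (++-identityʳ x)) e) walk-x)
  dyck-++-zeros≢dyck-++-false∷ x w (suc r) walk-x walk-w up-z e =
    hasUp⇒≢zeros r up-z (proj₂ (walk-prefix-unique x w walk-x walk-w e))

  decomposition-unique : ∀ ws ws' x x' r r' → All (IsDyck m) ws → All (IsDyck m) ws' →
    IsNonEmptyDyck m x → IsNonEmptyDyck m x' → length ws + r ≡ length ws' + r' →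
    blocks ws ++ x ++ zeros r ≡ blocks ws' ++ x' ++ zeros r' → ws ≡ ws' × x ≡ x' × r ≡ r'
  decomposition-unique [] [] x x' r .r _ _ _ _ refl e = refl , ++-cancelʳ (zeros r) x x' e , refl
  decomposition-unique [] (w' ∷ ws') x x' r r' _ (walk-w' ∷ _) (walk-x , _) ne-x' _ e =
    ⊥-elim (dyck-++-zeros≢dyck-++-false∷ x w' r walk-x walk-w'
      (nonEmptyDyck-hasUp-infix (blocks ws') (zeros r') ne-x') (trans e (blocks-∷-++ w' ws' _)))
  decomposition-unique (w ∷ ws) [] x x' r r' (walk-w ∷ _) _ ne-x (walk-x' , _) _ e =
    ⊥-elim (dyck-++-zeros≢dyck-++-false∷ x' w r' walk-x' walk-w
      (nonEmptyDyck-hasUp-infix (blocks ws) (zeros r) ne-x) (trans (sym e) (blocks-∷-++ w ws _)))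
  decomposition-unique (w ∷ ws) (w' ∷ ws') x x' r r' (walk-w ∷ walk-ws) (walk-w' ∷ walk-ws')
                       ne-x ne-x' len e
    with walk-prefix-unique w w' walk-w walk-w'
           (trans (sym (blocks-∷-++ w ws _)) (trans e (blocks-∷-++ w' ws' _)))
  ... | refl , e' = map₁ (cong (w ∷_))
    (decomposition-unique ws ws' x x' r r' walk-ws walk-ws' ne-x ne-x' (suc-injective len) e')

  generator : List Word → ℕ → Word
  generator ws r = true ∷ blocks ws ++ peak m ++ zeros r

  star-generator : ∀ ws r x → star m (generator ws r) x ≡ true ∷ blocks ws ++ x ++ zeros r
  star-generator ws r x = begin
    star m (generator ws r) x
      ≡⟨ cong (λ z → star m ((true ∷ blocks ws) ++ true ∷ z) x)
              (trans (zeros-++ m r) (cong zeros (+-comm m r))) ⟩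
    star m ((true ∷ blocks ws) ++ true ∷ zeros (r + m)) x
      ≡⟨ star-lastPeak (true ∷ blocks ws) r x ⟩
    true ∷ blocks ws ++ x ++ zeros r ∎

  generator-nonEmptyDyck : ∀ ws r → All (IsDyck m) ws → length ws + r ≡ m →
                           IsNonEmptyDyck m (generator ws r)
  generator-nonEmptyDyck ws r walk-ws len =
    up (subst (λ h → Walk m h (blocks ws ++ peak m ++ zeros r)) len
         (walk-blocks ws walk-ws (walk-++ {k = 0} (up (walk-zeros m)) (walk-zeros r)))) , λ ()

  PeakAt : ∀ {n} → Fin (suc n) → Vec Word (suc n) → Set
  PeakAt i ws = (∀ j → toℕ j < toℕ i → IsDyck m (lookup ws j))
              × lookup ws i ≡ peak m
              × (∀ j → toℕ j > toℕ i → lookup ws j ≡ [])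

  peakAt⇒blocks : ∀ n (i : Fin (suc n)) w (ws : Vec Word n) → PeakAt i (w ∷ ws) →
    Σ (List Word) λ us → Σ ℕ λ r → length us + r ≡ n × All (IsDyck m) us ×
      w ++ concatMap (false ∷_) (toList ws) ≡ blocks us ++ peak m ++ zeros r
  peakAt⇒blocks n zero w ws (_ , refl , after) =
    [] , n , refl , [] , cong (peak m ++_) (interleave-empty ws (λ j → after (suc j) (s≤s z≤n)))
  peakAt⇒blocks (suc n) (suc i) w (v ∷ ws) (before , at , after)
    with peakAt⇒blocks n i v ws ((λ j p → before (suc j) (s≤s p)) , at , (λ j p → after (suc j) (s≤s p)))
  ... | us , r , len , walk-us , e =
    w ∷ us , r , cong suc len , before zero (s≤s z≤n) ∷ walk-us ,
    trans (cong (λ z → w ++ false ∷ z) e) (sym (blocks-∷-++ w us _))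

  blocks⇒peakAt : ∀ n us r → length us + r ≡ n → All (IsDyck m) us →
    Σ (Fin (suc n)) λ i → Σ Word λ w → Σ (Vec Word n) λ ws →
      PeakAt i (w ∷ ws) × blocks us ++ peak m ++ zeros r ≡ w ++ concatMap (false ∷_) (toList ws)
  blocks⇒peakAt n [] r refl [] =
    zero , peak m , Vec.replicate r [] , ((λ _ ()) , refl , after) ,
    cong (peak m ++_) (sym (interleave-empty (Vec.replicate r []) (λ j → after (suc j) (s≤s z≤n))))
    where
      after : ∀ j → toℕ j > 0 → lookup (peak m ∷ Vec.replicate r []) j ≡ []
      after (suc j) _ = lookup-replicate j []
  blocks⇒peakAt n (u ∷ us) r refl (walk-u ∷ walk-us) with blocks⇒peakAt _ us r refl walk-us
  ... | i , w , ws , (before , at , after) , e =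
    suc i , u , w ∷ ws , (before′ , at , after′) ,
    trans (blocks-∷-++ u us _) (cong (λ z → u ++ false ∷ z) e)
    where
      before′ : ∀ j → toℕ j < toℕ (suc i) → IsDyck m (lookup (u ∷ w ∷ ws) j)
      before′ zero    _       = walk-u
      before′ (suc j) (s≤s p) = before j p
      after′ : ∀ j → toℕ j > toℕ (suc i) → lookup (u ∷ w ∷ ws) j ≡ []
      after′ (suc j) (s≤s p) = after j p

  isGenerator⇒generator : ∀ g → IsGenerator m g → Σ (List Word) λ us → Σ ℕ λ r →
    All (IsDyck m) us × length us + r ≡ m × g ≡ generator us r
  isGenerator⇒generator g (i , w ∷ ws , before , at , after , refl)
    with peakAt⇒blocks m i w ws (before , at , after)
  ... | us , r , len , walk-us , e = us , r , walk-us , len , cong (true ∷_) e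

  generator-isGenerator : ∀ us r → All (IsDyck m) us → length us + r ≡ m →
                          IsGenerator m (generator us r)
  generator-isGenerator us r walk-us len with blocks⇒peakAt m us r len walk-us
  ... | i , w , ws , (before , at , after) , e = i , w ∷ ws , before , at , after , cong (true ∷_) e

  isGenerator-nonEmptyDyck : ∀ g → IsGenerator m g → IsNonEmptyDyck m g
  isGenerator-nonEmptyDyck g is-g with isGenerator⇒generator g is-g
  ... | us , r , walk-us , len , refl = generator-nonEmptyDyck us r walk-us len

  prod-nonEmptyDyck : ∀ gs → All (IsGenerator m) gs → IsNonEmptyDyck m (prod m gs)
  prod-nonEmptyDyck []       []           = peak-nonEmptyDyck
  prod-nonEmptyDyck (g ∷ gs) (is-g ∷ gens) =
    star-closed g (prod m gs) (isGenerator-nonEmptyDyck g is-g) (prod-nonEmptyDyck gs gens)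

  factorise : ∀ n w → size w ≤ n → IsNonEmptyDyck m w →
              Σ (List Word) λ gs → All (IsGenerator m) gs × prod m gs ≡ w
  factorise n w _ (end , w≢[]) = ⊥-elim (w≢[] refl)
  factorise n (true ∷ w) _ (up wk , _) with decompose m wk
  ... | inj₁ refl = [] , [] , refl
  factorise (suc n) (true ∷ w) (s≤s size≤n) (up wk , _)
    | inj₂ (ws , x , r , len , walk-ws , ne-x , refl)
    with factorise n x (≤-trans (size-infix (blocks ws) x (zeros r)) size≤n) ne-x
  ... | gs , gens , prod≡x =
    generator ws r ∷ gs , generator-isGenerator ws r walk-ws len ∷ gens ,
    trans (cong (star m (generator ws r)) prod≡x) (star-generator ws r x)

  peak≢prod-∷ : ∀ g gs → IsGenerator m g → All (IsGenerator m) gs → peak m ≢ prod m (g ∷ gs)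
  peak≢prod-∷ g gs is-g gens e with isGenerator⇒generator g is-g
  ... | us , r , _ , _ , refl =
    hasUp⇒≢zeros m (nonEmptyDyck-hasUp-infix (blocks us) (zeros r) (prod-nonEmptyDyck gs gens))
      (∷-injectiveʳ (trans e (star-generator us r _)))

  prod-injective : ∀ gs hs → All (IsGenerator m) gs → All (IsGenerator m) hs →
                   prod m gs ≡ prod m hs → gs ≡ hs
  prod-injective []       []       _             _             _ = refl
  prod-injective []       (h ∷ hs) _             (is-h ∷ gens) e = ⊥-elim (peak≢prod-∷ h hs is-h gens e)
  prod-injective (g ∷ gs) []       (is-g ∷ gens) _             e = ⊥-elim (peak≢prod-∷ g gs is-g gens (sym e))
  prod-injective (g ∷ gs) (h ∷ hs) (is-g ∷ gens) (is-h ∷ gens′) e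
    with isGenerator⇒generator g is-g | isGenerator⇒generator h is-h
  ... | us , r , walk-us , len , refl | us′ , r′ , walk-us′ , len′ , refl
    with decomposition-unique us us′ _ _ r r′ walk-us walk-us′
           (prod-nonEmptyDyck gs gens) (prod-nonEmptyDyck hs gens′) (trans len (sym len′))
           (∷-injectiveʳ (trans (sym (star-generator us r _)) (trans e (star-generator us′ r′ _))))
  ... | refl , prods≡ , refl = cong (generator us r ∷_) (prod-injective gs hs gens gens′ prods≡)

proposition2p2 : (m : ℕ) → 1 ≤ m →
      -- 𝒟_m is closed under *
      (∀ u v → IsNonEmptyDyck m u → IsNonEmptyDyck m v → IsNonEmptyDyck m (star m u v))
      -- monoid with unit 10^m
    × IsNonEmptyDyck m (peak m)
    × (∀ u → IsNonEmptyDyck m u → star m (peak m) u ≡ u)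
    × (∀ u → IsNonEmptyDyck m u → star m u (peak m) ≡ u)
    × (∀ u v w → IsNonEmptyDyck m u → IsNonEmptyDyck m v → IsNonEmptyDyck m w →
         star m (star m u v) w ≡ star m u (star m v w))
      -- graded by size - 1 : deg (u * v) = deg u + deg v
    × (∀ u v → IsNonEmptyDyck m u → IsNonEmptyDyck m v →
         size (star m u v) + 1 ≡ size u + size v)
      -- the generators lie in 𝒟_m
    × (∀ g → IsGenerator m g → IsNonEmptyDyck m g)
      -- freeness: every element is a product of generators …
    × (∀ w → IsNonEmptyDyck m w →
         Σ (List Word) λ gs → All (IsGenerator m) gs × prod m gs ≡ w)
      -- … in exactly one way
    × (∀ gs hs → All (IsGenerator m) gs → All (IsGenerator m) hs →
         prod m gs ≡ prod m hs → gs ≡ hs)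
proposition2p2 m _ =
  star-closed m , peak-nonEmptyDyck m , (λ u _ → star-identityˡ m u) , star-identityʳ m ,
  (λ u v w ne-u ne-v _ → star-assoc m u v w ne-u ne-v) , (λ u v ne-u _ → size-star m u v ne-u) ,
  isGenerator-nonEmptyDyck m , (λ w ne-w → factorise m (size w) w ≤-refl ne-w) , prod-injective m
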